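{- Let $S_1,S_2$ be numerical semigroups and $a_1,a_2$ positive integers such that $S=a_1S_1+_{a_1a_2}a_2S_2$ is a numerical semigroup (a gluing). Then $S_1\le_P S$ and $S_2\le_P S$, in each case with a relating polynomial $f\in\mathbb N[x]$; that is, for each $i\in\{1,2\}$ there exist an integer $w\ge1$ and $f\in\mathbb N[x]$ with $\mathrm H_{S_i}(x^w)f(x)=\mathrm H_S(x)$.
   Context: A numerical semigroup is a submonoid of $(\mathbb N,+)$ with finite complement; its Hilbert series is $\mathrm H_S(x)=\sum_{s\in S}x^s$. For submonoids $T,T_1,T_2$ of $\mathbb N$, $T$ is the gluing of $T_1$ and $T_2$, written $T=T_1+_dT_2$ with $d=\mathrm{lcm}(\gcd(T_1),\gcd(T_2))$, if $T=T_1+T_2=\{t_1+t_2\mid t_i\in T_i\}$ and $d\in T_1\cap T_2$. Here $a_iS_i=\{a_is\mid s\in S_i\}$; when $S$ is a numerical semigroup, $\gcd(a_1,a_2)=1$ so $d=a_1a_2$. For numerical semigroups $U,V$, $U\le_P V$ (polynomially related) means there exist $f\in\mathbb Z[x]$ and an integer $w\ge1$ with $\mathrm H_U(x^w)f(x)=\mathrm H_V(x)$. -}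

module Defs where

open import Data.Nat using (ℕ; zero; suc; _+_; _*_; _∸_; _≤_; _≡ᵇ_)
open import Data.Nat.Properties using ()
open import Data.Bool using (Bool; true; false; if_then_else_)
open import Data.List using (List; []; _∷_; map; upTo)
open import Data.Nat.ListAction using (sum)
open import Data.Product using (Σ; ∃; _×_; _,_)
open import Relation.Nullary using (Dec; yes; no)
open import Relation.Nullary.Decidable using (⌊_⌋)
open import Relation.Binary.PropositionalEquality using (_≡_)

record NumericalSemigroup : Set₁ where
  field
    _∈S    : ℕ → Set
    dec    : (n : ℕ) → Dec (n ∈S)
    zero∈  : 0 ∈S
    closed : ∀ {m n} → m ∈S → n ∈S → (m + n) ∈S
    cofinite : ∃ λ b → ∀ n → b ≤ n → n ∈S

open NumericalSemigroup public

PowerSeries : Set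
PowerSeries = ℕ → ℕ

-- Polynomials in ℕ[x] as coefficient lists (constant term first).
Poly : Set
Poly = List ℕ

coeff : Poly → ℕ → ℕ
coeff []       _       = 0
coeff (c ∷ cs) zero    = c
coeff (c ∷ cs) (suc n) = coeff cs n

Σ≤ : ℕ → (ℕ → ℕ) → ℕ
Σ≤ n g = sum (map g (upTo (suc n)))

-- Hilbert series H_S(x) = Σ_{s∈S} x^s
hilbert : NumericalSemigroup → PowerSeries
hilbert S n = if ⌊ dec S n ⌋ then 1 else 0

-- Substitution x ↦ x^w :  (g(x^w))_n = Σ_{k ≤ n, k*w = n} g_k
substPow : ℕ → PowerSeries → PowerSeries
substPow w g n = Σ≤ n (λ k → if (k * w) ≡ᵇ n then g k else 0)

mulPoly : PowerSeries → Poly → PowerSeries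
mulPoly g f n = Σ≤ n (λ j → g (n ∸ j) * coeff f j)

PolyRelatedℕ : NumericalSemigroup → NumericalSemigroup → Set
PolyRelatedℕ U V =
  Σ ℕ λ w → (1 ≤ w) × Σ Poly λ f →
    ∀ n → mulPoly (substPow w (hilbert U)) f n ≡ hilbert V n

-- T = a₁S₁ +_{a₁a₂} a₂S₂  (gluing), as a statement about the set of S:
-- S = a₁S₁ + a₂S₂ and a₁a₂ ∈ a₁S₁ ∩ a₂S₂.
IsGluing : NumericalSemigroup → ℕ → NumericalSemigroup → ℕ → NumericalSemigroup → Set
IsGluing S a₁ S₁ a₂ S₂ =
  (∀ n → (S ∈S) n → Σ ℕ λ s₁ → Σ ℕ λ s₂ → (S₁ ∈S) s₁ × (S₂ ∈S) s₂ × n ≡ a₁ * s₁ + a₂ * s₂)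
  × (∀ s₁ s₂ → (S₁ ∈S) s₁ → (S₂ ∈S) s₂ → (S ∈S) (a₁ * s₁ + a₂ * s₂))
  × (Σ ℕ λ s₁ → (S₁ ∈S) s₁ × a₁ * s₁ ≡ a₁ * a₂)
  × (Σ ℕ λ s₂ → (S₂ ∈S) s₂ × a₂ * s₂ ≡ a₁ * a₂)

{-# OPTIONS --safe #-}
module Submission where

-- Since a₁a₂ lies in a₁S₁ ∩ a₂S₂ we have a₂ ∈ S₁ and a₁ ∈ S₂, and a₁, a₂ are coprime
-- because S has finite complement. Let Ap = {t ∈ S₂ | t − a₁ ∉ S₂} be the Apéry set of
-- a₁ in S₂; it is finite, and every element of S can be written as a₁s + a₂t with
-- s ∈ S₁, t ∈ Ap: move multiples of a₁ out of the S₂-part, paying with multiples of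
-- a₂ ∈ S₁ in the S₁-part. The representation is unique, since two of them force
-- t ≡ t' (mod a₁) and distinct Apéry elements are incongruent mod a₁. Hence
-- H_S(x) = H_{S₁}(x^{a₁}) · Σ_{t ∈ Ap} x^{a₂t}, and symmetrically for S₂.

open import Defs
open import Data.Nat
open import Data.Nat.Properties
open import Data.Nat.Divisibility
open _∣_ using (quotient; equality)
open import Data.Nat.Coprimality using (Coprime; coprime-divisor)
open import Data.Nat.Induction using (<-rec)
open import Data.Nat.ListAction using (sum)
open import Data.Nat.Tactic.RingSolver using (solve-∀)
open import Data.Bool using (true; false; T; if_then_else_)
open import Data.List using (_∷_; map; applyUpTo; upTo)
open import Algebra.Properties.CommutativeSemigroup +-commutativeSemigroup
  using (x∙yz≈y∙xz; xy∙z≈x∙zy)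
open import Data.Product using (Σ; _×_; _,_; proj₁; proj₂)
open import Data.Sum using (_⊎_; inj₁; inj₂)
open import Function using (_∘_; id)
open import Relation.Nullary using (Dec; yes; no; ¬_; contradiction)
open import Relation.Nullary.Decidable using (⌊_⌋; _×-dec_; _→-dec_; ¬?)
open import Relation.Binary.PropositionalEquality

map-applyUpTo : ∀ (g f : ℕ → ℕ) n → map g (applyUpTo f n) ≡ applyUpTo (g ∘ f) n
map-applyUpTo g f zero    = refl
map-applyUpTo g f (suc n) = cong (g (f 0) ∷_) (map-applyUpTo g (f ∘ suc) n)

sum-applyUpTo-zero : ∀ {n} g → (∀ j → j < n → g j ≡ 0) → sum (applyUpTo g n) ≡ 0
sum-applyUpTo-zero {zero}  g vanish = refl
sum-applyUpTo-zero {suc n} g vanish =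
  cong₂ _+_ (vanish 0 z<s) (sum-applyUpTo-zero (g ∘ suc) (λ j j<n → vanish (suc j) (s<s j<n)))

sum-applyUpTo-single : ∀ {n} g j₀ → j₀ < n → (∀ j → j < n → j ≢ j₀ → g j ≡ 0) →
                       sum (applyUpTo g n) ≡ g j₀
sum-applyUpTo-single {suc n} g zero _ vanish =
  trans (cong (g 0 +_) (sum-applyUpTo-zero (g ∘ suc) (λ j j<n → vanish (suc j) (s<s j<n) (λ ()))))
        (+-identityʳ (g 0))
sum-applyUpTo-single {suc n} g (suc j₀) j₀<n vanish =
  trans (cong (_+ sum (applyUpTo (g ∘ suc) n)) (vanish 0 z<s (λ ())))
        (sum-applyUpTo-single (g ∘ suc) j₀ (s<s⁻¹ j₀<n)
          (λ j j<n j≢j₀ → vanish (suc j) (s<s j<n) (j≢j₀ ∘ suc-injective)))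

Σ≤-zero : ∀ n g → (∀ j → j ≤ n → g j ≡ 0) → Σ≤ n g ≡ 0
Σ≤-zero n g vanish =
  trans (cong sum (map-applyUpTo g id (suc n))) (sum-applyUpTo-zero g (λ j → vanish j ∘ s≤s⁻¹))

Σ≤-single : ∀ n g j₀ → j₀ ≤ n → (∀ j → j ≤ n → j ≢ j₀ → g j ≡ 0) → Σ≤ n g ≡ g j₀
Σ≤-single n g j₀ j₀≤n vanish =
  trans (cong sum (map-applyUpTo g id (suc n)))
        (sum-applyUpTo-single g j₀ (s≤s j₀≤n) (λ j → vanish j ∘ s≤s⁻¹))

coeff-applyUpTo : ∀ {N} g → (∀ j → N ≤ j → g j ≡ 0) → ∀ j → coeff (applyUpTo g N) j ≡ g j
coeff-applyUpTo {zero}  g vanish j       = sym (vanish j z≤n)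
coeff-applyUpTo {suc N} g vanish zero    = refl
coeff-applyUpTo {suc N} g vanish (suc j) =
  coeff-applyUpTo (g ∘ suc) (λ i N≤i → vanish (suc i) (s≤s N≤i)) j

coeff-map-upTo : ∀ {N} c → (∀ j → N ≤ j → c j ≡ 0) → ∀ j → coeff (map c (upTo N)) j ≡ c j
coeff-map-upTo {N} c vanish j =
  trans (cong (λ f → coeff f j) (map-applyUpTo c id N)) (coeff-applyUpTo c vanish j)

𝟙 : {P : Set} → Dec P → ℕ
𝟙 d = if ⌊ d ⌋ then 1 else 0

𝟙-yes : {P : Set} (d : Dec P) → P → 𝟙 d ≡ 1
𝟙-yes (yes _) _ = refl
𝟙-yes (no ¬p) p = contradiction p ¬p

𝟙-no : {P : Set} (d : Dec P) → ¬ P → 𝟙 d ≡ 0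
𝟙-no (yes p) ¬p = contradiction p ¬p
𝟙-no (no _)  _  = refl

if-≡ᵇ-≡ : ∀ {m n} x → m ≡ n → (if m ≡ᵇ n then x else 0) ≡ x
if-≡ᵇ-≡ {m} {n} x m≡n with m ≡ᵇ n in eq
... | true  = refl
... | false = contradiction (subst T eq (≡⇒≡ᵇ m n m≡n)) λ ()

if-≡ᵇ-≢ : ∀ {m n} x → m ≢ n → (if m ≡ᵇ n then x else 0) ≡ 0
if-≡ᵇ-≢ {m} {n} x m≢n with m ≡ᵇ n in eq
... | true  = contradiction (≡ᵇ⇒≡ m n (subst T (sym eq) _)) m≢n
... | false = refl

substPow-multiple : ∀ {w} .{{_ : NonZero w}} g {m} q → m ≡ q * w → substPow w g m ≡ g q
substPow-multiple {w} g {m} q m≡qw =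
  trans (Σ≤-single m _ q (subst (q ≤_) (sym m≡qw) (m≤m*n q w)) off) (if-≡ᵇ-≡ (g q) (sym m≡qw))
  where
  off : ∀ j → j ≤ m → j ≢ q → (if j * w ≡ᵇ m then g j else 0) ≡ 0
  off j _ j≢q = if-≡ᵇ-≢ (g j) (λ jw≡m → j≢q (*-cancelʳ-≡ j q w (trans jw≡m m≡qw)))

substPow-nonmultiple : ∀ w g {m} → ¬ (w ∣ m) → substPow w g m ≡ 0
substPow-nonmultiple w g {m} w∤m =
  Σ≤-zero m _ (λ j _ → if-≡ᵇ-≢ (g j) (λ jw≡m → w∤m (divides j (sym jw≡m))))

substPow-𝟙-support : ∀ {w} .{{_ : NonZero w}} {P : ℕ → Set} (P? : ∀ k → Dec (P k)) m →
                     substPow w (𝟙 ∘ P?) m ≡ 0 ⊎ Σ ℕ λ q → m ≡ q * w × P q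
substPow-𝟙-support {w} P? m with w ∣? m
... | no w∤m = inj₁ (substPow-nonmultiple w (𝟙 ∘ P?) w∤m)
... | yes (divides q m≡qw) with P? q
...   | yes p = inj₂ (q , m≡qw , p)
...   | no ¬p = inj₁ (trans (substPow-multiple (𝟙 ∘ P?) q m≡qw) (𝟙-no (P? q) ¬p))

substPow-𝟙-yes : ∀ {w} .{{_ : NonZero w}} {P : ℕ → Set} (P? : ∀ k → Dec (P k)) {m} q →
                 m ≡ q * w → P q → substPow w (𝟙 ∘ P?) m ≡ 1
substPow-𝟙-yes P? q m≡qw p = trans (substPow-multiple (𝟙 ∘ P?) q m≡qw) (𝟙-yes (P? q) p)

split-at : ∀ {n j x y} → j ≤ n → n ∸ j ≡ x → j ≡ y → n ≡ x + y
split-at j≤n n∸j≡x j≡y = trans (sym (m∸n+n≡m j≤n)) (cong₂ _+_ n∸j≡x j≡y)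

*-closed : (T : NumericalSemigroup) {x : ℕ} → (T ∈S) x → ∀ k → (T ∈S) (k * x)
*-closed T x∈T zero    = zero∈ T
*-closed T x∈T (suc k) = closed T x∈T (*-closed T x∈T k)

common-divisor≡1 : (T : NumericalSemigroup) {d : ℕ} → (∀ {n} → (T ∈S) n → d ∣ n) → d ≡ 1
common-divisor≡1 T {d} d∣T = ∣1⇒≡1 (∣m+n∣m⇒∣n d∣b+1 (d∣T (large b ≤-refl)))
  where
  b = proj₁ (cofinite T)
  large = proj₂ (cofinite T)
  d∣b+1 : d ∣ b + 1
  d∣b+1 = subst (d ∣_) (+-comm 1 b) (d∣T (large (suc b) (n≤1+n b)))

Apéry : NumericalSemigroup → ℕ → ℕ → Set
Apéry T m t = (T ∈S) t × (m ≤ t → ¬ (T ∈S) (t ∸ m))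

apéry? : ∀ T m t → Dec (Apéry T m t)
apéry? T m t = dec T t ×-dec (m ≤? t →-dec ¬? (dec T (t ∸ m)))

apéry-large : (T : NumericalSemigroup) {m t : ℕ} → proj₁ (cofinite T) + m ≤ t → ¬ Apéry T m t
apéry-large T {m} {t} b+m≤t (_ , minimal) =
  minimal (≤-trans (m≤n+m m _) b+m≤t)
          (proj₂ (cofinite T) (t ∸ m) (subst (_≤ t ∸ m) (m+n∸n≡m _ m) (∸-monoˡ-≤ m b+m≤t)))

apéry-minimal : (T : NumericalSemigroup) {m t u : ℕ} (q : ℕ) → (T ∈S) m → Apéry T m t → (T ∈S) u →
                t ≡ u + q * m → t ≡ u
apéry-minimal T {m} {t} {u} zero    _   _                 _   t≡u+0 = trans t≡u+0 (+-identityʳ u)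
apéry-minimal T {m} {t} {u} (suc q) m∈T (_ , minimal) u∈T t≡ =
  contradiction (subst (T ∈S) (sym t∸m≡) (closed T u∈T (*-closed T m∈T q))) (minimal m≤t)
  where
  t≡m+ : t ≡ m + (u + q * m)
  t≡m+ = trans t≡ (x∙yz≈y∙xz u m (q * m))
  m≤t : m ≤ t
  m≤t = subst (m ≤_) (sym t≡m+) (m≤m+n m _)
  t∸m≡ : t ∸ m ≡ u + q * m
  t∸m≡ = trans (cong (_∸ m) t≡m+) (m+n∸m≡n m _)

apéry-decompose : (T : NumericalSemigroup) {m : ℕ} .{{_ : NonZero m}} (t : ℕ) → (T ∈S) t →
                  Σ ℕ λ q → Σ ℕ λ u → Apéry T m u × t ≡ u + q * m
apéry-decompose T {m} = <-rec _ step
  where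
  step : ∀ t → (∀ {s} → s < t → (T ∈S) s → Σ ℕ λ q → Σ ℕ λ u → Apéry T m u × s ≡ u + q * m) →
         (T ∈S) t → Σ ℕ λ q → Σ ℕ λ u → Apéry T m u × t ≡ u + q * m
  step t rec t∈T with m ≤? t
  ... | no m≰t = 0 , t , (t∈T , λ m≤t → contradiction m≤t m≰t) , sym (+-identityʳ t)
  ... | yes m≤t with dec T (t ∸ m)
  ...   | no t∸m∉T = 0 , t , (t∈T , λ _ → t∸m∉T) , sym (+-identityʳ t)
  ...   | yes t∸m∈T with rec (∸-monoʳ-< (>-nonZero⁻¹ m) m≤t) t∸m∈T
  ...     | q , u , apu , t∸m≡ = suc q , u , apu , t≡
    where
    t≡ : t ≡ u + suc q * m
    t≡ = begin
      t                   ≡⟨ m∸n+n≡m m≤t ⟨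
      t ∸ m + m           ≡⟨ cong (_+ m) t∸m≡ ⟩
      u + q * m + m       ≡⟨ xy∙z≈x∙zy u (q * m) m ⟩
      u + suc q * m       ∎
      where open ≡-Reasoning

IsGluing-swap : ∀ S a₁ S₁ a₂ S₂ → IsGluing S a₁ S₁ a₂ S₂ → IsGluing S a₂ S₂ a₁ S₁
IsGluing-swap S a₁ S₁ a₂ S₂ (split , glue , (s₁ , s₁∈S₁ , a₁s₁≡) , (s₂ , s₂∈S₂ , a₂s₂≡)) =
  (λ n n∈S → let (x , y , x∈ , y∈ , n≡) = split n n∈S
             in y , x , y∈ , x∈ , trans n≡ (+-comm (a₁ * x) (a₂ * y))) ,
  (λ y x y∈ x∈ → subst (S ∈S) (+-comm (a₁ * x) (a₂ * y)) (glue x y x∈ y∈)) ,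
  (s₂ , s₂∈S₂ , trans a₂s₂≡ (*-comm a₁ a₂)) ,
  (s₁ , s₁∈S₁ , trans a₁s₁≡ (*-comm a₁ a₂))

module Gluing (S₁ S₂ S : NumericalSemigroup) (a₁ a₂ : ℕ) .{{_ : NonZero a₁}} .{{_ : NonZero a₂}}
              (G : IsGluing S a₁ S₁ a₂ S₂) where

  Ap : ℕ → Set
  Ap = Apéry S₂ a₁

  a₂∈S₁ : (S₁ ∈S) a₂
  a₂∈S₁ with proj₁ (proj₂ (proj₂ G))
  ... | s , s∈S₁ , a₁s≡a₁a₂ = subst (S₁ ∈S) (*-cancelˡ-≡ s a₂ a₁ a₁s≡a₁a₂) s∈S₁

  a₁∈S₂ : (S₂ ∈S) a₁
  a₁∈S₂ with proj₂ (proj₂ (proj₂ G))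
  ... | s , s∈S₂ , a₂s≡a₁a₂ =
    subst (S₂ ∈S) (*-cancelˡ-≡ s a₁ a₂ (trans a₂s≡a₁a₂ (*-comm a₁ a₂))) s∈S₂

  coprime : Coprime a₁ a₂
  coprime (d∣a₁ , d∣a₂) = common-divisor≡1 S d∣S
    where
    d∣S : ∀ {n} → (S ∈S) n → _ ∣ n
    d∣S {n} n∈S with proj₁ G n n∈S
    ... | s₁ , s₂ , _ , _ , n≡ =
      subst (_ ∣_) (sym n≡) (∣m∣n⇒∣m+n (∣-trans d∣a₁ (m∣m*n s₁)) (∣-trans d∣a₂ (m∣m*n s₂)))

  glue : ∀ {s t} → (S₁ ∈S) s → (S₂ ∈S) t → (S ∈S) (s * a₁ + t * a₂)
  glue {s} {t} s∈S₁ t∈S₂ =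
    subst (S ∈S) (cong₂ _+_ (*-comm a₁ s) (*-comm a₂ t)) (proj₁ (proj₂ G) s t s∈S₁ t∈S₂)

  represent : ∀ {n} → (S ∈S) n → Σ ℕ λ s → Σ ℕ λ t → (S₁ ∈S) s × Ap t × n ≡ s * a₁ + t * a₂
  represent {n} n∈S with proj₁ G n n∈S
  ... | s₁ , s₂ , s₁∈S₁ , s₂∈S₂ , n≡ with apéry-decompose S₂ {a₁} s₂ s₂∈S₂
  ...   | q , t , apt , s₂≡ =
    s₁ + q * a₂ , t , closed S₁ s₁∈S₁ (*-closed S₁ a₂∈S₁ q) , apt ,
    trans n≡ (trans (cong (λ x → a₁ * s₁ + a₂ * x) s₂≡) (regroup a₁ a₂ s₁ t q))
    where
    regroup : ∀ a₁ a₂ s₁ t q → a₁ * s₁ + a₂ * (t + q * a₁) ≡ (s₁ + q * a₂) * a₁ + t * a₂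
    regroup = solve-∀

  represent-unique-≤ : ∀ {s s' t t'} → Ap t → Ap t' → t' ≤ t →
                       s * a₁ + t * a₂ ≡ s' * a₁ + t' * a₂ → t ≡ t'
  represent-unique-≤ {s} {s'} {t} {t'} apt apt' t'≤t eq =
    apéry-minimal S₂ (quotient a₁∣d) a₁∈S₂ apt (proj₁ apt')
      (trans (sym (m+[n∸m]≡n t'≤t)) (cong (t' +_) (equality a₁∣d)))
    where
    d = t ∸ t'
    cancelled : s * a₁ + a₂ * d ≡ s' * a₁
    cancelled = +-cancelʳ-≡ (t' * a₂) _ _ (begin
      s * a₁ + a₂ * d + t' * a₂   ≡⟨ regroup s a₁ a₂ d t' ⟩
      s * a₁ + (t' + d) * a₂      ≡⟨ cong (λ x → s * a₁ + x * a₂) (m+[n∸m]≡n t'≤t) ⟩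
      s * a₁ + t * a₂             ≡⟨ eq ⟩
      s' * a₁ + t' * a₂           ∎)
      where
      open ≡-Reasoning
      regroup : ∀ s a₁ a₂ d t' → s * a₁ + a₂ * d + t' * a₂ ≡ s * a₁ + (t' + d) * a₂
      regroup = solve-∀
    a₁∣a₂d : a₁ ∣ a₂ * d
    a₁∣a₂d = ∣m+n∣m⇒∣n (subst (a₁ ∣_) (sym cancelled) (n∣m*n s')) (n∣m*n s)
    a₁∣d : a₁ ∣ d
    a₁∣d = coprime-divisor coprime a₁∣a₂d

  represent-unique : ∀ {s s' t t'} → Ap t → Ap t' →
                     s * a₁ + t * a₂ ≡ s' * a₁ + t' * a₂ → t ≡ t'
  represent-unique {s} {s'} {t} {t'} apt apt' eq with ≤-total t' t
  ... | inj₁ t'≤t = represent-unique-≤ {s} {s'} apt apt' t'≤t eq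
  ... | inj₂ t≤t' = sym (represent-unique-≤ {s'} {s} apt' apt t≤t' (sym eq))

  apéryIndicator : ℕ → ℕ
  apéryIndicator = substPow a₂ (𝟙 ∘ apéry? S₂ a₁)

  apéryPoly : Poly
  apéryPoly = map apéryIndicator (upTo ((proj₁ (cofinite S₂) + a₁) * a₂))

  coeff-apéryPoly : ∀ j → coeff apéryPoly j ≡ apéryIndicator j
  coeff-apéryPoly = coeff-map-upTo apéryIndicator vanish
    where
    vanish : ∀ j → (proj₁ (cofinite S₂) + a₁) * a₂ ≤ j → apéryIndicator j ≡ 0
    vanish j N≤j with substPow-𝟙-support {a₂} (apéry? S₂ a₁) j
    ... | inj₁ vanishes = vanishes
    ... | inj₂ (q , j≡qa₂ , apq) =
      contradiction apq (apéry-large S₂ (*-cancelʳ-≤ _ q a₂ (subst (_ ≤_) j≡qa₂ N≤j)))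

  term : ℕ → ℕ → ℕ
  term n j = substPow a₁ (hilbert S₁) (n ∸ j) * coeff apéryPoly j

  Support : ℕ → ℕ → Set
  Support n j = Σ ℕ λ s → Σ ℕ λ t → (S₁ ∈S) s × Ap t × n ∸ j ≡ s * a₁ × j ≡ t * a₂

  term-support : ∀ n j → term n j ≡ 0 ⊎ Support n j
  term-support n j rewrite coeff-apéryPoly j
    with substPow-𝟙-support {a₁} (dec S₁) (n ∸ j) | substPow-𝟙-support {a₂} (apéry? S₂ a₁) j
  ... | inj₁ zero₁ | _          = inj₁ (cong (_* apéryIndicator j) zero₁)
  ... | inj₂ _     | inj₁ zero₂ = inj₁ (trans (cong (x *_) zero₂) (*-zeroʳ x))
    where x = substPow a₁ (hilbert S₁) (n ∸ j)
  ... | inj₂ (s , n∸j≡ , s∈S₁) | inj₂ (t , j≡ , apt) = inj₂ (s , t , s∈S₁ , apt , n∸j≡ , j≡)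

  term-on-support : ∀ {n j} → Support n j → term n j ≡ 1
  term-on-support {n} {j} (s , t , s∈S₁ , apt , n∸j≡ , j≡) =
    cong₂ _*_ (substPow-𝟙-yes {a₁} (dec S₁) s n∸j≡ s∈S₁)
              (trans (coeff-apéryPoly j) (substPow-𝟙-yes {a₂} (apéry? S₂ a₁) t j≡ apt))

  hilbert-gluing : ∀ n → mulPoly (substPow a₁ (hilbert S₁)) apéryPoly n ≡ hilbert S n
  hilbert-gluing n with dec S n
  ... | no n∉S = Σ≤-zero n (term n) absent
    where
    absent : ∀ j → j ≤ n → term n j ≡ 0
    absent j j≤n with term-support n j
    ... | inj₁ vanishes = vanishes
    ... | inj₂ (s , t , s∈S₁ , apt , n∸j≡ , j≡) =
      contradiction (subst (S ∈S) (sym (split-at j≤n n∸j≡ j≡)) (glue s∈S₁ (proj₁ apt))) n∉S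
  ... | yes n∈S with represent n∈S
  ...   | s , t , s∈S₁ , apt , n≡ =
    trans (Σ≤-single n (term n) (t * a₂) j₀≤n elsewhere)
          (term-on-support (s , t , s∈S₁ , apt , n∸j₀≡ , refl))
    where
    j₀≤n : t * a₂ ≤ n
    j₀≤n = subst (t * a₂ ≤_) (sym n≡) (m≤n+m (t * a₂) (s * a₁))
    n∸j₀≡ : n ∸ t * a₂ ≡ s * a₁
    n∸j₀≡ = trans (cong (_∸ t * a₂) n≡) (m+n∸n≡m (s * a₁) (t * a₂))
    elsewhere : ∀ j → j ≤ n → j ≢ t * a₂ → term n j ≡ 0
    elsewhere j j≤n j≢j₀ with term-support n j
    ... | inj₁ vanishes = vanishes
    ... | inj₂ (s' , t' , _ , apt' , n∸j≡ , j≡) =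
      contradiction (trans j≡ (cong (_* a₂) t'≡t)) j≢j₀
      where
      t'≡t : t' ≡ t
      t'≡t = represent-unique {s'} {s} apt' apt (trans (sym (split-at j≤n n∸j≡ j≡)) n≡)

gluing-polyRelated : ∀ S₁ S₂ S a₁ a₂ → 1 ≤ a₁ → 1 ≤ a₂ → IsGluing S a₁ S₁ a₂ S₂ →
                     PolyRelatedℕ S₁ S
gluing-polyRelated S₁ S₂ S a₁ a₂ 1≤a₁ 1≤a₂ G =
  a₁ , 1≤a₁ , apéryPoly , hilbert-gluing
  where
  instance
    a₁≢0 : NonZero a₁
    a₁≢0 = >-nonZero 1≤a₁
    a₂≢0 : NonZero a₂
    a₂≢0 = >-nonZero 1≤a₂
  open Gluing S₁ S₂ S a₁ a₂ G

mainTheorem7 : (S₁ S₂ S : NumericalSemigroup) (a₁ a₂ : ℕ) → 1 ≤ a₁ → 1 ≤ a₂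
    → IsGluing S a₁ S₁ a₂ S₂
    → PolyRelatedℕ S₁ S × PolyRelatedℕ S₂ S
mainTheorem7 S₁ S₂ S a₁ a₂ 1≤a₁ 1≤a₂ G =
  gluing-polyRelated S₁ S₂ S a₁ a₂ 1≤a₁ 1≤a₂ G ,
  gluing-polyRelated S₂ S₁ S a₂ a₁ 1≤a₂ 1≤a₁ (IsGluing-swap S a₁ S₁ a₂ S₂ G)
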